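{- For every positive integer $a$ there are constants $C_{a,r}$, $r\in\{0,1,\dots,a-1\}$, such that for every positive integer $k$ with $k\equiv r\pmod a$, $$\alpha(k,2k+1)\le\frac{(3a+1)k+C_{a,r}}{a}.$$
   Context: For integers $1\le k\le n$, $\alpha(k,n)$ denotes the least number of entries equal to $1$ in an $n\times n$ matrix with entries in $\{0,1\}$ in which every $k\times k$ minor (the submatrix formed by any $k$ rows and any $k$ columns) contains at least one entry equal to $1$. -}

module Defs where

open import Data.Nat using (ℕ; _≤_; _+_)
open import Data.Bool using (Bool; true; false; if_then_else_)
open import Data.Fin using (Fin)
open import Data.Fin.Subset using (Subset; _∈_; ∣_∣)
open import Data.Product using (Σ; _×_; ∃; ∃-syntax)
open import Data.List using (map; allFin)
open import Data.Nat.ListAction using (sum)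
open import Relation.Binary.PropositionalEquality using (_≡_)

Matrix01 : ℕ → Set
Matrix01 n = Fin n → Fin n → Bool

ones : ∀ {n} → Matrix01 n → ℕ
ones {n} M = sum (map (λ i → sum (map (λ j → if M i j then 1 else 0) (allFin n))) (allFin n))

EveryMinorHasOne : (k n : ℕ) → Matrix01 n → Set
EveryMinorHasOne k n M =
  (R C : Subset n) → ∣ R ∣ ≡ k → ∣ C ∣ ≡ k →
  ∃[ i ] ∃[ j ] (i ∈ R × j ∈ C × M i j ≡ true)

IsAlpha : (k n m : ℕ) → Set
IsAlpha k n m =
  (∃[ M ] (EveryMinorHasOne k n M × ones M ≡ m)) ×
  ((M : Matrix01 n) → EveryMinorHasOne k n M → m ≤ ones M)

-- Take L = a (or L = 1 when k < a). On indices 0 … M − 1, M = k − L, the matrix is the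
-- identity; the remaining s = k + L + 1 indices form the cycle ℤ/s, where p is joined to
-- p, p + 1 and, for multiples p of L, to p + L + 1. That is about 3k + k/L ones.
-- A zero k × k minor leaves disjoint sets r (rows) and c (columns) on the cycle with
-- |r|, |c| ≥ L and |r| + |c| ≥ s − 1, and no step or chord from r into c. Walking once round
-- the cycle from the only point outside r ∪ c, a point of r is followed by points of r, so
-- the walk reads c…c r…r with at least L letters of each kind; among its last L points is
-- a multiple of L, and its chord lands among the first L points, in c.
module Submission where

open import Defs
open import Data.Bool using (Bool; true; false; _∨_; _∧_; not; if_then_else_)
open import Data.Bool.Properties using (∨-zeroʳ) renaming (_≟_ to _≟ᵇ_)
open import Data.Empty using (⊥; ⊥-elim)
import Data.Fin as Fin
open import Data.Fin using (Fin; toℕ; fromℕ<)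
open import Data.Fin.Properties using (any?; toℕ-fromℕ<)
open import Data.Fin.Subset using (Subset; ∣_∣)
open import Data.Fin.Subset.Properties using (_∈?_)
open import Data.List using (map; allFin; tabulate)
open import Data.List.Properties using (map-tabulate)
open import Data.Nat using (ℕ; NonZero; zero; suc; _+_; _*_; _∸_; _%_; _/_; _<_; _≤_; _≤?_; _≡ᵇ_; _<ᵇ_; z≤n; s≤s; s≤s⁻¹)
open import Data.Nat.DivMod
open import Data.Nat.ListAction using (sum)
open import Data.Nat.Properties
open import Algebra.Properties.CommutativeSemigroup +-commutativeSemigroup using (interchange)
open import Data.Nat.Tactic.RingSolver using (solve-∀)
open import Data.Product using (Σ; _×_; _,_; ∃; proj₁; proj₂)
open import Data.Sum using (_⊎_; inj₁; inj₂)
open import Data.Vec using (Vec; []; _∷_; lookup)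
open import Data.Vec.Properties using (lookup⇒[]=)
open import Function using (_∘_; id)
open import Relation.Binary.PropositionalEquality using (_≡_; refl; sym; trans; cong; cong₂; subst; subst₂; module ≡-Reasoning)
open import Relation.Nullary using (yes; no)
open import Relation.Nullary.Decidable using (_×-dec_)

ind : Bool → ℕ
ind b = if b then 1 else 0

ind≤1 : ∀ b → ind b ≤ 1
ind≤1 true  = ≤-refl
ind≤1 false = z≤n

∑ : ℕ → (ℕ → ℕ) → ℕ
∑ zero    f = 0
∑ (suc N) f = f 0 + ∑ N (f ∘ suc)

∑-split : ∀ m n f → ∑ (m + n) f ≡ ∑ m f + ∑ n (λ t → f (m + t))
∑-split zero    n f = refl
∑-split (suc m) n f = trans (cong (f 0 +_) (∑-split m n (f ∘ suc))) (sym (+-assoc (f 0) _ _))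

∑-cong : ∀ N {f g} → (∀ t → t < N → f t ≡ g t) → ∑ N f ≡ ∑ N g
∑-cong zero    eq = refl
∑-cong (suc N) eq = cong₂ _+_ (eq 0 (s≤s z≤n)) (∑-cong N (λ t t<N → eq (suc t) (s≤s t<N)))

∑-mono : ∀ N {f g} → (∀ t → t < N → f t ≤ g t) → ∑ N f ≤ ∑ N g
∑-mono zero    le = z≤n
∑-mono (suc N) le = +-mono-≤ (le 0 (s≤s z≤n)) (∑-mono N (λ t t<N → le (suc t) (s≤s t<N)))

∑-distrib-+ : ∀ N f g → ∑ N (λ t → f t + g t) ≡ ∑ N f + ∑ N g
∑-distrib-+ zero    f g = refl
∑-distrib-+ (suc N) f g = begin
  f 0 + g 0 + ∑ N (λ t → f (suc t) + g (suc t))   ≡⟨ cong (f 0 + g 0 +_) (∑-distrib-+ N (f ∘ suc) (g ∘ suc)) ⟩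
  f 0 + g 0 + (∑ N (f ∘ suc) + ∑ N (g ∘ suc))     ≡⟨ interchange (f 0) (g 0) _ _ ⟩
  f 0 + ∑ N (f ∘ suc) + (g 0 + ∑ N (g ∘ suc))     ∎
  where open ≡-Reasoning

∑-suc : ∀ N f → ∑ (suc N) f ≡ ∑ N f + f N
∑-suc zero    f = +-comm (f 0) 0
∑-suc (suc N) f = trans (cong (f 0 +_) (∑-suc N (f ∘ suc))) (sym (+-assoc (f 0) _ _))

∑-const : ∀ N c → ∑ N (λ _ → c) ≡ N * c
∑-const zero    c = refl
∑-const (suc N) c = cong (c +_) (∑-const N c)

count : ℕ → (ℕ → Bool) → ℕ
count N f = ∑ N (ind ∘ f)

count≤ : ∀ N f → count N f ≤ N
count≤ zero    f = z≤n
count≤ (suc N) f = +-mono-≤ (ind≤1 (f 0)) (count≤ N (f ∘ suc))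

count-false : ∀ N {f} → (∀ t → t < N → f t ≡ false) → count N f ≡ 0
count-false zero    none = refl
count-false (suc N) {f} none rewrite none 0 (s≤s z≤n) =
  count-false N (λ t t<N → none (suc t) (s≤s t<N))

count≡0⇒false : ∀ N {f} → count N f ≡ 0 → ∀ t → t < N → f t ≡ false
count≡0⇒false (suc N) {f} eq zero    _ with f 0
... | false = refl
count≡0⇒false (suc N) {f} eq (suc t) (s≤s t<N) with f 0
... | false = count≡0⇒false N eq t t<N

count>0⇒witness : ∀ N {f} → 0 < count N f → ∃ λ t → t < N × f t ≡ true
count>0⇒witness (suc N) {f} pos with f 0 in f0
... | true  = 0 , s≤s z≤n , f0
... | false with count>0⇒witness N pos
...   | t , t<N , ft = suc t , s≤s t<N , ft

count-∨-≤ : ∀ N f g → count N (λ t → f t ∨ g t) ≤ count N f + count N g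
count-∨-≤ N f g = ≤-trans (∑-mono N (λ t _ → ind-∨ (f t) (g t))) (≤-reflexive (∑-distrib-+ N _ _))
  where
  ind-∨ : ∀ x y → ind (x ∨ y) ≤ ind x + ind y
  ind-∨ true  y = s≤s z≤n
  ind-∨ false y = ≤-refl

count-∨-disjoint : ∀ N {f g} → (∀ t → t < N → f t ≡ true → g t ≡ true → ⊥) →
                   count N (λ t → f t ∨ g t) ≡ count N f + count N g
count-∨-disjoint N {f} {g} disj = trans (∑-cong N ind-∨) (∑-distrib-+ N _ _)
  where
  ind-∨ : ∀ t → t < N → ind (f t ∨ g t) ≡ ind (f t) + ind (g t)
  ind-∨ t t<N with f t in ft | g t in gt
  ... | true  | true  = ⊥-elim (disj t t<N ft gt)
  ... | true  | false = refl
  ... | false | _     = refl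

count-not : ∀ N f → count N f + count N (not ∘ f) ≡ N
count-not N f = trans (sym (∑-distrib-+ N _ _)) (trans (∑-cong N one) (trans (∑-const N 1) (*-identityʳ N)))
  where
  one : ∀ t → t < N → ind (f t) + ind (not (f t)) ≡ 1
  one t _ with f t
  ... | true  = refl
  ... | false = refl

count-≡ᵇ : ∀ N v → count N (_≡ᵇ v) ≤ 1
count-≡ᵇ zero    v       = z≤n
count-≡ᵇ (suc N) zero    = ≤-reflexive (cong suc (count-false N (λ _ _ → refl)))
count-≡ᵇ (suc N) (suc v) = count-≡ᵇ N v

count-∧-≡ᵇ : ∀ N d v → count N (λ u → d ∧ (u ≡ᵇ v)) ≤ ind d
count-∧-≡ᵇ N false v = ≤-reflexive (count-false N (λ _ _ → refl))
count-∧-≡ᵇ N true  v = count-≡ᵇ N v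

count-mono-+ : ∀ N x f → count N f ≤ count (N + x) f
count-mono-+ N x f = subst (count N f ≤_) (sym (∑-split N x (ind ∘ f))) (m≤m+n _ _)

count-split : ∀ {t N} f → t ≤ N → count N f ≡ count t f + count (N ∸ t) (λ u → f (t + u))
count-split {t} {N} f t≤N =
  trans (cong (λ m → count m f) (sym (m+[n∸m]≡n t≤N))) (∑-split t (N ∸ t) (ind ∘ f))

UpwardClosed : ℕ → (ℕ → Bool) → Set
UpwardClosed N f = ∀ {t u} → t ≤ u → u < N → f t ≡ true → f u ≡ true

DownwardClosed : ℕ → (ℕ → Bool) → Set
DownwardClosed N f = ∀ {t u} → t ≤ u → u < N → f u ≡ true → f t ≡ true

upwardClosed-suffix : ∀ {N L f} → UpwardClosed N f → L ≤ count N f →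
                      ∀ {t} → N ≤ L + t → t < N → f t ≡ true
upwardClosed-suffix {N} {L} {f} up L≤count {t} N≤L+t t<N with f t in ft
... | true  = refl
... | false = ⊥-elim (<⇒≱ L+t<N N≤L+t)
  where
  below : ∀ u → u < suc t → f u ≡ false
  below u u≤t with f u in fu
  ... | false = refl
  ... | true  = trans (sym (up (s≤s⁻¹ u≤t) t<N fu)) ft
  count≤rest : count N f ≤ N ∸ suc t
  count≤rest = begin
    count N f                                             ≡⟨ count-split f t<N ⟩
    count (suc t) f + count (N ∸ suc t) (λ u → f (suc t + u)) ≡⟨ cong (_+ count (N ∸ suc t) (λ u → f (suc t + u))) (count-false (suc t) below) ⟩
    count (N ∸ suc t) (λ u → f (suc t + u))               ≤⟨ count≤ (N ∸ suc t) _ ⟩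
    N ∸ suc t                                             ∎
    where open ≤-Reasoning
  L+t<N : L + t < N
  L+t<N = subst (_≤ N) (+-suc L t) (m≤o∸n⇒m+n≤o L t<N (≤-trans L≤count count≤rest))

downwardClosed-prefix : ∀ {N L f} → DownwardClosed N f → L ≤ count N f →
                        ∀ {t} → t < L → t < N → f t ≡ true
downwardClosed-prefix {N} {L} {f} down L≤count {t} t<L t<N with f t in ft
... | true  = refl
... | false = ⊥-elim (<⇒≱ t<L (≤-trans L≤count count≤t))
  where
  above : ∀ u → u < N ∸ t → f (t + u) ≡ false
  above u u<N∸t with f (t + u) in fu
  ... | false = refl
  ... | true  = trans (sym (down (m≤m+n t u) t+u<N fu)) ft
    where
    t+u<N : t + u < N
    t+u<N = subst (t + u <_) (m+[n∸m]≡n (<⇒≤ t<N)) (+-monoʳ-< t u<N∸t)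
  count≤t : count N f ≤ t
  count≤t = begin
    count N f                                     ≡⟨ count-split f (<⇒≤ t<N) ⟩
    count t f + count (N ∸ t) (λ u → f (t + u))   ≡⟨ cong (count t f +_) (count-false (N ∸ t) above) ⟩
    count t f + 0                                 ≤⟨ ≤-reflexive (+-identityʳ _) ⟩
    count t f                                     ≤⟨ count≤ t f ⟩
    t                                             ∎
    where open ≤-Reasoning

count-multiples-blocks : ∀ l q → count (q * suc l) (λ p → p % suc l ≡ᵇ 0) ≡ q
count-multiples-blocks l zero    = refl
count-multiples-blocks l (suc q) = begin
  count (suc l + q * suc l) multiple                                  ≡⟨ ∑-split (suc l) (q * suc l) (ind ∘ multiple) ⟩
  count (suc l) multiple + count (q * suc l) (λ p → multiple (suc l + p)) ≡⟨ cong₂ _+_ first-block (∑-cong (q * suc l) periodic) ⟩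
  1 + count (q * suc l) multiple                                      ≡⟨ cong suc (count-multiples-blocks l q) ⟩
  suc q                                                               ∎
  where
  open ≡-Reasoning
  multiple : ℕ → Bool
  multiple p = p % suc l ≡ᵇ 0
  first-block : count (suc l) multiple ≡ 1
  first-block = cong suc (count-false l (λ t t<l → cong (_≡ᵇ 0) (m<n⇒m%n≡m (s≤s t<l))))
  periodic : ∀ p → p < q * suc l → ind (multiple (suc l + p)) ≡ ind (multiple p)
  periodic p _ = cong (λ r → ind (r ≡ᵇ 0)) (trans (cong (_% suc l) (+-comm (suc l) p)) ([m+n]%n≡m%n p (suc l)))

count-multiples : ∀ l N → suc l * count N (λ p → p % suc l ≡ᵇ 0) ≤ N + suc l
count-multiples l N = begin
  L * count N multiple           ≤⟨ *-monoʳ-≤ L (count-mono-+ N (suc q * L ∸ N) multiple) ⟩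
  L * count (N + (suc q * L ∸ N)) multiple ≡⟨ cong (λ m → L * count m multiple) (m+[n∸m]≡n (<⇒≤ N<[1+q]L)) ⟩
  L * count (suc q * L) multiple ≡⟨ cong (L *_) (count-multiples-blocks l (suc q)) ⟩
  L * suc q                      ≡⟨ *-suc L q ⟩
  L + L * q                      ≡⟨ cong (L +_) (*-comm L q) ⟩
  L + q * L                      ≤⟨ +-monoʳ-≤ L (m/n*n≤m N L) ⟩
  L + N                          ≡⟨ +-comm L N ⟩
  N + L                          ∎
  where
  open ≤-Reasoning
  L q : ℕ
  L = suc l
  q = N / L
  multiple : ℕ → Bool
  multiple p = p % L ≡ᵇ 0
  N<[1+q]L : N < suc q * L
  N<[1+q]L = begin-strict
    N               ≡⟨ m≡m%n+[m/n]*n N L ⟩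
    N % L + q * L   <⟨ +-monoˡ-< (q * L) (m%n<n N L) ⟩
    L + q * L       ∎

multiple-ahead : ∀ l u → ∃ λ j → j < suc l × (u + j) % suc l ≡ 0
multiple-ahead l zero = 0 , s≤s z≤n , refl
multiple-ahead l (suc u) with multiple-ahead l u
... | suc j , j<L , div = j , <-trans (n<1+n j) j<L , trans (cong (_% suc l) (sym (+-suc u j))) div
... | zero  , _   , div = l , ≤-refl , (begin
  (suc u + l) % suc l ≡⟨ cong (_% suc l) (sym (+-suc u l)) ⟩
  (u + suc l) % suc l ≡⟨ [m+n]%n≡m%n u (suc l) ⟩
  u % suc l           ≡⟨ cong (_% suc l) (sym (+-identityʳ u)) ⟩
  (u + 0) % suc l     ≡⟨ div ⟩
  0                   ∎)
  where open ≡-Reasoning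

[m%n+o]%n≡[m+o]%n : ∀ m o n .{{_ : NonZero n}} → (m % n + o) % n ≡ (m + o) % n
[m%n+o]%n≡[m+o]%n m o n = begin
  (m % n + o) % n           ≡⟨ %-distribˡ-+ (m % n) o n ⟩
  (m % n % n + o % n) % n   ≡⟨ cong (λ r → (r + o % n) % n) (m%n%n≡m%n m n) ⟩
  (m % n + o % n) % n       ≡⟨ %-distribˡ-+ m o n ⟨
  (m + o) % n               ∎
  where open ≡-Reasoning

-- If the multiple of suc l found after x % s lies beyond s, the residues wrap around through 0 first.
multiple-in-cyclic-window : ∀ l s .{{_ : NonZero s}} x → ∃ λ j → j < suc l × (x + j) % s % suc l ≡ 0
multiple-in-cyclic-window l s x with multiple-ahead l (x % s)
... | j , j<L , div with x % s + j <? s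
...   | yes u+j<s = j , j<L , (begin
  (x + j) % s % suc l       ≡⟨ cong (_% suc l) ([m%n+o]%n≡[m+o]%n x j s) ⟨
  (x % s + j) % s % suc l   ≡⟨ cong (_% suc l) (m<n⇒m%n≡m u+j<s) ⟩
  (x % s + j) % suc l       ≡⟨ div ⟩
  0                         ∎)
  where open ≡-Reasoning
...   | no  u+j≮s = s ∸ x % s , ≤-<-trans (m≤n+o⇒m∸n≤o s (x % s) (≮⇒≥ u+j≮s)) j<L , (begin
  (x + (s ∸ x % s)) % s % suc l       ≡⟨ cong (_% suc l) ([m%n+o]%n≡[m+o]%n x (s ∸ x % s) s) ⟨
  (x % s + (s ∸ x % s)) % s % suc l   ≡⟨ cong (λ r → r % s % suc l) (m+[n∸m]≡n (<⇒≤ (m%n<n x s))) ⟩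
  s % s % suc l                       ≡⟨ cong (_% suc l) (n%n≡0 s) ⟩
  0                                   ∎)
  where open ≡-Reasoning

sum-tabulate : ∀ n (φ : Fin n → ℕ) (g : ℕ → ℕ) → (∀ i → φ i ≡ g (toℕ i)) → sum (tabulate φ) ≡ ∑ n g
sum-tabulate zero    φ g eq = refl
sum-tabulate (suc n) φ g eq = cong₂ _+_ (eq Fin.zero) (sum-tabulate n (φ ∘ Fin.suc) (g ∘ suc) (eq ∘ Fin.suc))

ones-ℕ : ∀ n (E : ℕ → ℕ → Bool) → ones {n} (λ i j → E (toℕ i) (toℕ j)) ≡ ∑ n (λ i → count n (E i))
ones-ℕ n E = trans (cong sum (map-tabulate id rowSum)) (sum-tabulate n rowSum _ row)
  where
  entries : Fin n → Fin n → ℕ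
  entries i j = ind (E (toℕ i) (toℕ j))
  rowSum : Fin n → ℕ
  rowSum i = sum (map (entries i) (allFin n))
  row : ∀ i → rowSum i ≡ count n (E (toℕ i))
  row i = trans (cong sum (map-tabulate id (entries i))) (sum-tabulate n (entries i) _ (λ _ → refl))

lookupℕ : ∀ {n} → Vec Bool n → ℕ → Bool
lookupℕ []      _       = false
lookupℕ (x ∷ v) zero    = x
lookupℕ (x ∷ v) (suc i) = lookupℕ v i

lookup-fromℕ< : ∀ {n} (v : Vec Bool n) {i} (i<n : i < n) → lookup v (fromℕ< i<n) ≡ lookupℕ v i
lookup-fromℕ< (x ∷ v) {zero}  _         = refl
lookup-fromℕ< (x ∷ v) {suc i} (s≤s i<n) = lookup-fromℕ< v i<n

∣∣≡count : ∀ {n} (p : Subset n) → ∣ p ∣ ≡ count n (lookupℕ p)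
∣∣≡count []          = refl
∣∣≡count (true ∷ p)  = cong suc (∣∣≡count p)
∣∣≡count (false ∷ p) = ∣∣≡count p

ZeroMinor : ℕ → (ℕ → ℕ → Bool) → (ℕ → Bool) → (ℕ → Bool) → Set
ZeroMinor n E r c = ∀ {i j} → i < n → j < n → r i ≡ true → c j ≡ true → E i j ≡ true → ⊥

everyMinorHasOne-ℕ : ∀ k n (E : ℕ → ℕ → Bool) →
  (∀ r c → count n r ≡ k → count n c ≡ k → ZeroMinor n E r c → ⊥) →
  EveryMinorHasOne k n (λ i j → E (toℕ i) (toℕ j))
everyMinorHasOne-ℕ k n E noZeroMinor R C ∣R∣ ∣C∣
  with any? (λ i → any? (λ j → (i ∈? R) ×-dec ((j ∈? C) ×-dec (E (toℕ i) (toℕ j) ≟ᵇ true))))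
... | yes (i , j , hit) = i , j , hit
... | no  miss = ⊥-elim (noZeroMinor (lookupℕ R) (lookupℕ C) (trans (sym (∣∣≡count R)) ∣R∣) (trans (sym (∣∣≡count C)) ∣C∣) zero-minor)
  where
  zero-minor : ZeroMinor n E (lookupℕ R) (lookupℕ C)
  zero-minor {i} {j} i<n j<n ri cj eij = miss (fromℕ< i<n , fromℕ< j<n ,
    lookup⇒[]= (fromℕ< i<n) R (trans (lookup-fromℕ< R i<n) ri) ,
    lookup⇒[]= (fromℕ< j<n) C (trans (lookup-fromℕ< C j<n) cj) ,
    subst₂ (λ x y → E x y ≡ true) (sym (toℕ-fromℕ< i<n)) (sym (toℕ-fromℕ< j<n)) eij)

-- The cycle ℤ/s with steps and chords

module Cycle (N l : ℕ) (L≤N : suc l ≤ N) where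

  L s : ℕ
  L = suc l
  s = suc N

  shift : ℕ → ℕ → ℕ
  shift d p = (p + d) % s

  data Arc : ℕ → ℕ → Set where
    loop  : ∀ p → Arc p p
    step  : ∀ p → Arc p (shift 1 p)
    chord : ∀ p → p % L ≡ 0 → Arc p (shift (suc L) p)

  arc-target<s : ∀ {p q} → p < s → Arc p q → q < s
  arc-target<s p<s (loop p)    = p<s
  arc-target<s _   (step p)    = m%n<n (p + 1) s
  arc-target<s _   (chord p _) = m%n<n (p + suc L) s

  NoArc : (r c : ℕ → Bool) → Set
  NoArc r c = ∀ {p q} → p < s → Arc p q → r p ≡ true → c q ≡ true → ⊥

  module Line (b : ℕ) where

    pos : ℕ → ℕ
    pos t = shift (suc t) b

    pos<s : ∀ t → pos t < s
    pos<s t = m%n<n (b + suc t) s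

    shift-pos : ∀ d t → shift d (pos t) ≡ pos (d + t)
    shift-pos d t = trans ([m%n+o]%n≡[m+o]%n (b + suc t) d s) (cong (_% s) (rearrange b t d))
      where
      rearrange : ∀ b t d → b + suc t + d ≡ b + suc (d + t)
      rearrange = solve-∀

    pos-wrap : ∀ j → pos (s + j) ≡ pos j
    pos-wrap j = trans (cong (_% s) (rearrange b j s)) ([m+n]%n≡m%n (b + suc j) s)
      where
      rearrange : ∀ b j n → b + suc (n + j) ≡ b + suc j + n
      rearrange = solve-∀

    ∑-rotate : b < s → ∀ g → ∑ s g ≡ g b + ∑ N (g ∘ pos)
    ∑-rotate b<s g = begin
      ∑ s g                                             ≡⟨ cong (λ m → ∑ m g) (sym 1+b+m≡s) ⟩
      ∑ (suc b + m) g                                   ≡⟨ ∑-split (suc b) m g ⟩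
      ∑ (suc b) g + ∑ m (λ t → g (suc b + t))           ≡⟨ cong₂ _+_ (∑-suc b g) (∑-cong m before-wrap) ⟩
      ∑ b g + g b + ∑ m (g ∘ pos)                       ≡⟨ rearrange (∑ b g) (g b) _ ⟩
      g b + (∑ m (g ∘ pos) + ∑ b g)                     ≡⟨ cong (λ x → g b + (∑ m (g ∘ pos) + x)) (∑-cong b after-wrap) ⟩
      g b + (∑ m (g ∘ pos) + ∑ b (λ t → g (pos (m + t)))) ≡⟨ cong (g b +_) (∑-split m b (g ∘ pos)) ⟨
      g b + ∑ (m + b) (g ∘ pos)                         ≡⟨ cong (λ n → g b + ∑ n (g ∘ pos)) (m∸n+n≡m b≤N) ⟩
      g b + ∑ N (g ∘ pos)                               ∎
      where
      open ≡-Reasoning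
      m : ℕ
      m = N ∸ b
      b≤N : b ≤ N
      b≤N = s≤s⁻¹ b<s
      1+b+m≡s : suc b + m ≡ s
      1+b+m≡s = cong suc (m+[n∸m]≡n b≤N)
      before-wrap : ∀ t → t < m → g (suc b + t) ≡ g (pos t)
      before-wrap t t<m = cong g (sym (trans (cong (_% s) (+-suc b t))
        (m<n⇒m%n≡m (subst (suc b + t <_) 1+b+m≡s (+-monoʳ-< (suc b) t<m)))))
      after-wrap : ∀ t → t < b → g t ≡ g (pos (m + t))
      after-wrap t t<b = cong g (sym (begin
        (b + suc (m + t)) % s ≡⟨ cong (_% s) (trans (+-suc b (m + t)) (cong suc (sym (+-assoc b m t)))) ⟩
        (suc b + m + t) % s   ≡⟨ cong (λ n → (n + t) % s) 1+b+m≡s ⟩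
        (s + t) % s           ≡⟨ cong (_% s) (+-comm s t) ⟩
        (t + s) % s           ≡⟨ [m+n]%n≡m%n t s ⟩
        t % s                 ≡⟨ m<n⇒m%n≡m (<-trans t<b b<s) ⟩
        t                     ∎))
      rearrange : ∀ x y z → x + y + z ≡ y + (z + x)
      rearrange = solve-∀

  module Separated {r c : ℕ → Bool} (noArc : NoArc r c) where

    blank : ℕ → Bool
    blank p = not (r p ∨ c p)

    count-blank≤1 : N ≤ count s r + count s c → count s blank ≤ 1
    count-blank≤1 total = +-cancelˡ-≤ (count s r + count s c) _ _ (begin
      count s r + count s c + count s blank     ≡⟨ cong (_+ count s blank) (count-∨-disjoint s (λ p p<s → noArc p<s (loop p))) ⟨
      count s (λ p → r p ∨ c p) + count s blank ≡⟨ count-not s (λ p → r p ∨ c p) ⟩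
      suc N                                     ≡⟨ +-comm 1 N ⟩
      N + 1                                     ≤⟨ +-monoˡ-≤ 1 total ⟩
      count s r + count s c + 1                 ∎)
      where open ≤-Reasoning

    -- The walk pos 0, …, pos (N − 1) passes every point of the cycle except b, and b is the only
    -- point that may lie outside r ∪ c.
    module Walk (b : ℕ) (b<s : b < s) (blanks≤ : count s blank ≤ ind (blank b)) where
      open Line b

      r′ c′ : ℕ → Bool
      r′ t = r (pos t)
      c′ t = c (pos t)

      covered : ∀ t → t < N → r′ t ≡ true ⊎ c′ t ≡ true
      covered t t<N = nonblank (count≡0⇒false N line-blanks t t<N)
        where
        line-blanks : count N (blank ∘ pos) ≡ 0
        line-blanks = n≤0⇒n≡0 (+-cancelˡ-≤ (ind (blank b)) _ 0 (begin
          ind (blank b) + count N (blank ∘ pos) ≡⟨ ∑-rotate b<s (ind ∘ blank) ⟨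
          count s blank                         ≤⟨ blanks≤ ⟩
          ind (blank b)                         ≡⟨ +-identityʳ _ ⟨
          ind (blank b) + 0                     ∎))
          where open ≤-Reasoning
        nonblank : ∀ {x y} → not (x ∨ y) ≡ false → x ≡ true ⊎ y ≡ true
        nonblank {true}          _ = inj₁ refl
        nonblank {false} {true}  _ = inj₂ refl

      r′-step : ∀ {t} → suc t < N → r′ t ≡ true → r′ (suc t) ≡ true
      r′-step {t} 1+t<N rt with covered (suc t) 1+t<N
      ... | inj₁ rt′ = rt′
      ... | inj₂ ct′ = ⊥-elim (noArc (pos<s t) (step (pos t)) rt (subst (λ q → c q ≡ true) (sym (shift-pos 1 t)) ct′))

      r′-upward : UpwardClosed N r′
      r′-upward {u = zero}  z≤n _ rt = rt
      r′-upward {t} {suc u} t≤1+u 1+u<N rt with m≤n⇒m<n∨m≡n t≤1+u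
      ... | inj₂ refl  = rt
      ... | inj₁ t<1+u = r′-step 1+u<N (r′-upward (s≤s⁻¹ t<1+u) (<-trans (n<1+n u) 1+u<N) rt)

      c′-downward : DownwardClosed N c′
      c′-downward {t} {u} t≤u u<N cu with covered t (≤-<-trans t≤u u<N)
      ... | inj₂ ct = ct
      ... | inj₁ rt = ⊥-elim (noArc (pos<s u) (loop (pos u)) (r′-upward t≤u u<N rt) cu)

      -- The last L points of the walk are in r and the first L in c; a chord leaves the last block for the first.
      from-blank : blank b ≡ true → L ≤ count s r → L ≤ count s c → ⊥
      from-blank bb Lr Lc with multiple-in-cyclic-window l s (b + suc (N ∸ L))
      ... | j , j<L , div = noArc (pos<s t) (chord (pos t) multiple) rt ct
        where
        t : ℕ
        t = N ∸ L + j
        count-line : ∀ f → f b ≡ false → count s f ≡ count N (f ∘ pos)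
        count-line f fb = trans (∑-rotate b<s (ind ∘ f)) (cong (λ x → ind x + count N (f ∘ pos)) fb)
        cleared : ∀ {x y} → not (x ∨ y) ≡ true → x ≡ false × y ≡ false
        cleared {false} {false} _ = refl , refl
        multiple : pos t % L ≡ 0
        multiple = trans (cong (λ x → x % s % L) (sym (+-assoc b (suc (N ∸ L)) j))) div
        rt : r (pos t) ≡ true
        rt = upwardClosed-suffix r′-upward (subst (L ≤_) (count-line r (proj₁ (cleared bb))) Lr)
               (subst (_≤ L + t) (m+[n∸m]≡n L≤N) (+-monoʳ-≤ L (m≤m+n (N ∸ L) j)))
               (subst (t <_) (m∸n+n≡m L≤N) (+-monoʳ-< (N ∸ L) j<L))
        ct : c (shift (suc L) (pos t)) ≡ true
        ct = subst (λ q → c q ≡ true) (sym (trans (shift-pos (suc L) t) (trans (cong pos wrap) (pos-wrap j))))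
               (downwardClosed-prefix c′-downward (subst (L ≤_) (count-line c (proj₂ (cleared bb))) Lc) j<L (<-≤-trans j<L L≤N))
          where
          wrap : suc L + t ≡ s + j
          wrap = cong suc (trans (sym (+-assoc L (N ∸ L) j)) (cong (_+ j) (m+[n∸m]≡n L≤N)))

      from-r : r b ≡ true → count s c ≡ 0
      from-r rb = trans (∑-rotate b<s (ind ∘ c)) (cong₂ _+_ (cong ind c-b) (count-false N c′-false))
        where
        r′0 : r′ 0 ≡ true
        r′0 with covered 0 (≤-trans (s≤s z≤n) L≤N)
        ... | inj₁ r0 = r0
        ... | inj₂ c0 = ⊥-elim (noArc b<s (step b) rb c0)
        c′-false : ∀ t → t < N → c′ t ≡ false
        c′-false t t<N with c′ t in ct
        ... | false = refl
        ... | true  = ⊥-elim (noArc (pos<s t) (loop (pos t)) (r′-upward z≤n t<N r′0) ct)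
        c-b : c b ≡ false
        c-b with c b in cb
        ... | false = refl
        ... | true  = ⊥-elim (noArc b<s (loop b) rb cb)

  no-large-separated-pair : ∀ {r c} → NoArc r c → L ≤ count s r → L ≤ count s c → N ≤ count s r + count s c → ⊥
  no-large-separated-pair {r} {c} noArc Lr Lc total with count s (Separated.blank noArc) in blanks
  ... | zero with count>0⇒witness s (≤-trans (s≤s z≤n) Lr)
  ...   | b , b<s , rb = <⇒≱ (s≤s z≤n) (subst (L ≤_) (Walk.from-r b b<s (subst (_≤ ind (blank b)) (sym blanks) z≤n) rb) Lc)
    where open Separated noArc
  no-large-separated-pair {r} {c} noArc Lr Lc total | suc _ with count>0⇒witness s (subst (0 <_) (sym blanks) (s≤s z≤n))
  ...   | b , b<s , bb = Walk.from-blank b b<s (subst (count s blank ≤_) (cong ind (sym bb)) (count-blank≤1 total)) bb Lr Lc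
    where open Separated noArc

-- The matrix

<ᵇ-true : ∀ {m n} → m < n → (m <ᵇ n) ≡ true
<ᵇ-true {m} {n} m<n with m <ᵇ n | <⇒<ᵇ m<n
... | true | _ = refl

<ᵇ-false : ∀ {m n} → n ≤ m → (m <ᵇ n) ≡ false
<ᵇ-false {m} {n} n≤m with m <ᵇ n | <ᵇ⇒< m n
... | false | _   = refl
... | true  | m<n = ⊥-elim (<⇒≱ (m<n _) n≤m)

≡ᵇ-refl : ∀ n → (n ≡ᵇ n) ≡ true
≡ᵇ-refl n with n ≡ᵇ n | ≡⇒≡ᵇ n n refl
... | true | _ = refl

module Construction (k l : ℕ) (L≤k : suc l ≤ k) where

  open Cycle (k + suc l) l (m≤n+m (suc l) k) public

  M n : ℕ
  M = k ∸ L
  n = 2 * k + 1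

  M+L≡k : M + L ≡ k
  M+L≡k = m∸n+n≡m L≤k

  M+s≡n : M + s ≡ n
  M+s≡n = subst (λ x → M + suc (x + L) ≡ 2 * x + 1) M+L≡k (identity M L)
    where
    identity : ∀ M L → M + suc (M + L + L) ≡ 2 * (M + L) + 1
    identity = solve-∀

  tailRow : ℕ → ℕ → Bool
  tailRow p j = (j ≡ᵇ M + p) ∨ ((j ≡ᵇ M + shift 1 p) ∨ ((p % L ≡ᵇ 0) ∧ (j ≡ᵇ M + shift (suc L) p)))

  entry : ℕ → ℕ → Bool
  entry i = if i <ᵇ M then (_≡ᵇ i) else tailRow (i ∸ M)

  matrix : Matrix01 n
  matrix i j = entry (toℕ i) (toℕ j)

  entry-head : ∀ {i} → i < M → entry i ≡ (_≡ᵇ i)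
  entry-head i<M rewrite <ᵇ-true i<M = refl

  entry-tail : ∀ p → entry (M + p) ≡ tailRow p
  entry-tail p rewrite <ᵇ-false (m≤m+n M p) | m+n∸m≡n M p = refl

  entry-arc : ∀ {p q} → Arc p q → entry (M + p) (M + q) ≡ true
  entry-arc {p} arc rewrite entry-tail p = tailRow-arc arc
    where
    tailRow-arc : ∀ {p q} → Arc p q → tailRow p (M + q) ≡ true
    tailRow-arc (loop p)      rewrite ≡ᵇ-refl (M + p) = refl
    tailRow-arc (step p)      rewrite ≡ᵇ-refl (M + shift 1 p) = ∨-zeroʳ _
    tailRow-arc (chord p div) rewrite div | ≡ᵇ-refl (M + shift (suc L) p) =
      ∨-∨-zeroʳ (M + shift (suc L) p ≡ᵇ M + p) (M + shift (suc L) p ≡ᵇ M + shift 1 p)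
      where
      ∨-∨-zeroʳ : ∀ x y → x ∨ (y ∨ true) ≡ true
      ∨-∨-zeroʳ x y = trans (cong (x ∨_) (∨-zeroʳ y)) (∨-zeroʳ x)

  ∑-head-tail : ∀ g → ∑ n g ≡ ∑ M g + ∑ s (λ p → g (M + p))
  ∑-head-tail g = trans (cong (λ m → ∑ m g) (sym M+s≡n)) (∑-split M s g)

  multiple : ℕ → Bool
  multiple p = p % L ≡ᵇ 0

  rowCount : ℕ → ℕ
  rowCount i = count n (entry i)

  tailRow-count : ∀ p → count n (tailRow p) ≤ 2 + ind (multiple p)
  tailRow-count p =
    ≤-trans (count-∨-≤ n (_≡ᵇ M + p) (λ j → (j ≡ᵇ M + shift 1 p) ∨ (multiple p ∧ (j ≡ᵇ M + shift (suc L) p))))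
    (+-mono-≤ (count-≡ᵇ n (M + p))
    (≤-trans (count-∨-≤ n (_≡ᵇ M + shift 1 p) (λ j → multiple p ∧ (j ≡ᵇ M + shift (suc L) p)))
    (+-mono-≤ (count-≡ᵇ n (M + shift 1 p)) (count-∧-≡ᵇ n (multiple p) (M + shift (suc L) p)))))

  ∑-rowCount : ∑ n rowCount ≤ n + s + count s multiple
  ∑-rowCount = begin
    ∑ n rowCount                                       ≡⟨ ∑-head-tail rowCount ⟩
    ∑ M rowCount + ∑ s (λ p → rowCount (M + p))        ≤⟨ +-mono-≤ head tail ⟩
    M * 1 + (s * 2 + count s multiple)                 ≡⟨ rearrange M s (count s multiple) ⟩
    M + s + s + count s multiple                       ≡⟨ cong (λ x → x + s + count s multiple) M+s≡n ⟩
    n + s + count s multiple                           ∎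
    where
    open ≤-Reasoning
    rearrange : ∀ M s c → M * 1 + (s * 2 + c) ≡ M + s + s + c
    rearrange = solve-∀
    head : ∑ M rowCount ≤ M * 1
    head = ≤-trans (∑-mono M (λ i i<M → subst (λ row → count n row ≤ 1) (sym (entry-head i<M)) (count-≡ᵇ n i)))
                   (≤-reflexive (∑-const M 1))
    tail : ∑ s (λ p → rowCount (M + p)) ≤ s * 2 + count s multiple
    tail = begin
      ∑ s (λ p → rowCount (M + p))              ≤⟨ ∑-mono s (λ p _ → subst (λ row → count n row ≤ 2 + ind (multiple p)) (sym (entry-tail p)) (tailRow-count p)) ⟩
      ∑ s (λ p → 2 + ind (multiple p))          ≡⟨ ∑-distrib-+ s (λ _ → 2) (ind ∘ multiple) ⟩
      ∑ s (λ _ → 2) + count s multiple          ≡⟨ cong (_+ count s multiple) (∑-const s 2) ⟩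
      s * 2 + count s multiple                  ∎

  ones-bound : L * ones matrix ≤ L * (n + s) + (s + L)
  ones-bound = begin
    L * ones matrix                        ≡⟨ cong (L *_) (ones-ℕ n entry) ⟩
    L * ∑ n rowCount                       ≤⟨ *-monoʳ-≤ L ∑-rowCount ⟩
    L * (n + s + count s multiple)         ≡⟨ *-distribˡ-+ L (n + s) _ ⟩
    L * (n + s) + L * count s multiple     ≤⟨ +-monoʳ-≤ (L * (n + s)) (count-multiples l s) ⟩
    L * (n + s) + (s + L)                  ∎
    where open ≤-Reasoning

  -- On the head a zero minor is a pair of disjoint sets, so at most M of its 2k rows and columns lie there.
  no-zero-minor : ∀ r c → count n r ≡ k → count n c ≡ k → ZeroMinor n entry r c → ⊥
  no-zero-minor r c ∣r∣ ∣c∣ zeroMinor = no-large-separated-pair noArc (tail-large r ∣r∣) (tail-large c ∣c∣) total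
    where
    open ≤-Reasoning
    r′ c′ : ℕ → Bool
    r′ p = r (M + p)
    c′ p = c (M + p)
    M+p<n : ∀ {p} → p < s → M + p < n
    M+p<n {p} p<s = subst (M + p <_) M+s≡n (+-monoʳ-< M p<s)
    noArc : NoArc r′ c′
    noArc p<s arc rp cq = zeroMinor (M+p<n p<s) (M+p<n (arc-target<s p<s arc)) rp cq (entry-arc arc)
    head-disjoint : ∀ i → i < M → r i ≡ true → c i ≡ true → ⊥
    head-disjoint i i<M ri ci = zeroMinor i<n i<n ri ci (trans (cong (λ row → row i) (entry-head i<M)) (≡ᵇ-refl i))
      where
      i<n : i < n
      i<n = <-≤-trans i<M (subst (M ≤_) M+s≡n (m≤m+n M s))
    head : count M r + count M c ≤ M
    head = subst (_≤ M) (count-∨-disjoint M head-disjoint) (count≤ M _)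
    tail-large : ∀ f → count n f ≡ k → L ≤ count s (λ p → f (M + p))
    tail-large f ∣f∣ = +-cancelˡ-≤ M L _ (begin
      M + L                                  ≡⟨ trans M+L≡k (sym ∣f∣) ⟩
      count n f                              ≡⟨ ∑-head-tail (ind ∘ f) ⟩
      count M f + count s (λ p → f (M + p))  ≤⟨ +-monoˡ-≤ _ (count≤ M f) ⟩
      M + count s (λ p → f (M + p))          ∎)
    total : k + L ≤ count s r′ + count s c′
    total = +-cancelˡ-≤ M (k + L) _ (begin
      M + (k + L)                                              ≡⟨ rearrange M k L ⟩
      (M + L) + k                                              ≡⟨ cong₂ _+_ (trans M+L≡k (sym ∣r∣)) (sym ∣c∣) ⟩
      count n r + count n c                                    ≡⟨ cong₂ _+_ (∑-head-tail (ind ∘ r)) (∑-head-tail (ind ∘ c)) ⟩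
      (count M r + count s r′) + (count M c + count s c′)      ≡⟨ interchange (count M r) _ _ _ ⟩
      (count M r + count M c) + (count s r′ + count s c′)      ≤⟨ +-monoˡ-≤ _ head ⟩
      M + (count s r′ + count s c′)                            ∎)
      where
      rearrange : ∀ M k L → M + (k + L) ≡ M + L + k
      rearrange = solve-∀

  matrix-minor : EveryMinorHasOne k n matrix
  matrix-minor = everyMinorHasOne-ℕ k n entry no-zero-minor

alpha-bound : ∀ {k l m} → suc l ≤ k → IsAlpha k (2 * k + 1) m →
              suc l * m ≤ suc l * (3 * k + suc l + 2) + (k + 2 * suc l + 1)
alpha-bound {k} {l} {m} L≤k (_ , minimal) = begin
  L * m                                       ≤⟨ *-monoʳ-≤ L (minimal matrix matrix-minor) ⟩
  L * ones matrix                             ≤⟨ ones-bound ⟩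
  L * (n + s) + (s + L)                       ≡⟨ identity k L ⟩
  L * (3 * k + L + 2) + (k + 2 * L + 1)       ∎
  where
  open ≤-Reasoning
  open Construction k l L≤k
  identity : ∀ k L → L * ((2 * k + 1) + suc (k + L)) + (suc (k + L) + L) ≡ L * (3 * k + L + 2) + (k + 2 * L + 1)
  identity = solve-∀

-- For k < a the construction with L = 1 gives α ≤ 4k + 6, and a k < a² is absorbed by the constant.
alpha-bound-uniform : ∀ l k m → 1 ≤ k → IsAlpha k (2 * k + 1) m →
                      suc l * m ≤ (3 * suc l + 1) * k + (suc l * suc l + 6 * suc l + 1)
alpha-bound-uniform l k m 1≤k isAlpha with suc l ≤? k
... | yes a≤k = begin
  a * m                                              ≤⟨ alpha-bound a≤k isAlpha ⟩
  a * (3 * k + a + 2) + (k + 2 * a + 1)              ≤⟨ m≤m+n _ (2 * a) ⟩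
  a * (3 * k + a + 2) + (k + 2 * a + 1) + 2 * a      ≡⟨ large a k ⟩
  (3 * a + 1) * k + (a * a + 6 * a + 1)              ∎
  where
  open ≤-Reasoning
  a : ℕ
  a = suc l
  large : ∀ a k → a * (3 * k + a + 2) + (k + 2 * a + 1) + 2 * a ≡ (3 * a + 1) * k + (a * a + 6 * a + 1)
  large = solve-∀
... | no  a≰k = begin
  a * m                                              ≤⟨ *-monoʳ-≤ a (subst (_≤ _) (*-identityˡ m) (alpha-bound 1≤k isAlpha)) ⟩
  a * (1 * (3 * k + 1 + 2) + (k + 2 * 1 + 1))        ≡⟨ small₁ a k ⟩
  a * (3 * k) + 6 * a + a * k                        ≤⟨ +-monoʳ-≤ _ (*-monoʳ-≤ a (<⇒≤ (≰⇒> a≰k))) ⟩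
  a * (3 * k) + 6 * a + a * a                        ≤⟨ m≤m+n _ (k + 1) ⟩
  a * (3 * k) + 6 * a + a * a + (k + 1)              ≡⟨ small₂ a k ⟩
  (3 * a + 1) * k + (a * a + 6 * a + 1)              ∎
  where
  open ≤-Reasoning
  a : ℕ
  a = suc l
  small₁ : ∀ a k → a * (1 * (3 * k + 1 + 2) + (k + 2 * 1 + 1)) ≡ a * (3 * k) + 6 * a + a * k
  small₁ = solve-∀
  small₂ : ∀ a k → a * (3 * k) + 6 * a + a * a + (k + 1) ≡ (3 * a + 1) * k + (a * a + 6 * a + 1)
  small₂ = solve-∀

open import Data.Integer using (ℤ; +_; +≤+) renaming (_+_ to _+ℤ_; _≤_ to _≤ℤ_)

theorem5 : (a : ℕ) → .{{_ : NonZero a}} →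
    Σ (ℕ → ℤ) λ C →
      (r : ℕ) → r < a → (k : ℕ) → 1 ≤ k → k % a ≡ r →
        (m : ℕ) → IsAlpha k (2 * k + 1) m →
          + (a * m) ≤ℤ + ((3 * a + 1) * k) +ℤ C r
theorem5 a@(suc l) = (λ _ → + (a * a + 6 * a + 1)) ,
  λ _ _ k 1≤k _ m isAlpha → +≤+ (alpha-bound-uniform l k m 1≤k isAlpha)
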